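{- Let $r\ge2$ and $k_1,\ldots,k_r\ge2$. Then \[\sum_{j=1}^r\omega_{\mathcal{A}}(k_1,\ldots,k_{j-1},k_j-1,k_{j+1},\ldots,k_r)=0\quad\text{in }\mathcal{A},\] \[\sum_{j=1}^r\Omega(k_1,\ldots,k_{j-1},k_j-1,k_{j+1},\ldots,k_r)=0.\]
   Context: $\mathcal{A}=\big(\prod_p\mathbb{F}_p\big)/\big(\bigoplus_p\mathbb{F}_p\big)$ over all primes. For an index $\mathbf{k}=(k_1,\ldots,k_r)$ with $r\ge2$: $\omega_n(\mathbf{k})=\sum_{m_1+\cdots+m_r=n,\,m_i>0}\prod_am_a^{ -k_a}$, $\omega_{\mathcal{A}}(\mathbf{k})=(\omega_p(\mathbf{k})\bmod p)_p$, and $\Omega(\mathbf{k})=\lim_{n\to\infty}\sum_{m_1+\cdots+m_r=n,\,m_i>0}\prod_a\frac{q^{(k_a-1)m_a}}{[m_a]^{k_a}}\big|_{q=e^{2\pi i/n}}$ with $[m]=\frac{1-q^m}{1-q}$; equivalently $\Omega(\mathbf{k})=\sum_{a=1}^r(-1)^{k_a}\zeta^{MT}(k_1,\ldots,k_{a-1},k_{a+1},\ldots,k_r;k_a)$, where $\zeta^{MT}(l_1,\ldots,l_s;l)=\sum_{m_i>0}\frac{1}{m_1^{l_1}\cdots m_s^{l_s}(m_1+\cdots+m_s)^l}$. -}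

module Defs where

open import Data.Nat as ℕ using (ℕ; zero; suc; _^_; _∸_)
open import Data.Nat.Divisibility using (_∣_)
open import Data.Integer as ℤ using (ℤ; +_; -[1+_])
open import Data.Rational as ℚ using (ℚ; 0ℚ; 1ℚ; _+_; _*_; _/_; -_; ↥_; ↧ₙ_)
open import Data.List as List using (List; []; _∷_; length; map; concatMap; foldr; upTo)
open import Relation.Nullary using (¬_)
open import Data.Product using (_×_)
open import Data.Nat.ListAction renaming (sum to sumℕ)

Index : Set
Index = List ℕ

Σℚ : List ℚ → ℚ
Σℚ = foldr _+_ 0ℚ

Πℚ : List ℚ → ℚ
Πℚ = foldr _*_ 1ℚ

-- 1/m as a rational (only ever applied to m > 0; 1/0 := 0 is irrelevant)
inv : ℕ → ℚ
inv zero    = 0ℚ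
inv (suc n) = + 1 / suc n

oneTo : ℕ → List ℕ
oneTo n = map suc (upTo n)

-- compositions r n : all (m_1,...,m_r) with m_i > 0 and m_1+...+m_r = n
compositions : ℕ → ℕ → List (List ℕ)
compositions zero    zero    = [] ∷ []
compositions zero    (suc n) = []
compositions (suc r) n =
  concatMap (λ m → map (m ∷_) (compositions r (n ∸ m))) (oneTo (n ∸ r))

prodInv : List ℕ → List ℕ → ℚ
prodInv (m ∷ ms) (k ∷ ks) = inv (m ^ k) * prodInv ms ks
prodInv _        _        = 1ℚ

ω : ℕ → Index → ℚ
ω n k = Σℚ (map (λ m → prodInv m k) (compositions (length k) n))

-- (k_1,...,k_{j-1},k_j - 1,k_{j+1},...,k_r)   (j counted from 0 here)
decAt : ℕ → Index → Index
decAt _       []       = []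
decAt zero    (k ∷ ks) = (k ∸ 1) ∷ ks
decAt (suc j) (k ∷ ks) = k ∷ decAt j ks

-- the rational x reduces to 0 in F_p : p does not divide the denominator
-- and p divides the numerator
≡0mod : ℕ → ℚ → Set
≡0mod p x = (¬ (p ∣ (↧ₙ x))) × (p ∣ ℤ.∣ ↥ x ∣)

-- Mordell–Tornheim partial sums over the box [1..N]^s
box : ℕ → ℕ → List (List ℕ)
box zero    N = [] ∷ []
box (suc s) N = concatMap (λ m → map (m ∷_) (box s N)) (oneTo N)

ζMT-partial : ℕ → Index → ℕ → ℚ
ζMT-partial N ls l =
  Σℚ (map (λ m → prodInv m ls * inv (sumℕ m ^ l)) (box (length ls) N))

-- remove the a-th entry (a counted from 0)
removeAt : ℕ → Index → Index
removeAt _       []       = []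
removeAt zero    (k ∷ ks) = ks
removeAt (suc a) (k ∷ ks) = k ∷ removeAt a ks

lookupD : Index → ℕ → ℕ
lookupD []       _       = 0
lookupD (k ∷ ks) zero    = k
lookupD (k ∷ ks) (suc a) = lookupD ks a

signℚ : ℕ → ℚ
signℚ zero          = 1ℚ
signℚ (suc zero)    = - 1ℚ
signℚ (suc (suc n)) = signℚ n

-- partial sum (box [1..N]) of
-- Ω(k) = Σ_a (-1)^{k_a} ζ^MT(k_1,..,k_{a-1},k_{a+1},..,k_r; k_a)
Ω-partial : ℕ → Index → ℚ
Ω-partial N k =
  Σℚ (map (λ a → signℚ (lookupD k a) * ζMT-partial N (removeAt a k) (lookupD k a))
          (upTo (length k)))

sumDec : (Index → ℚ) → Index → ℚ
sumDec f k = Σℚ (map (λ j → f (decAt j k)) (upTo (length k)))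

module Submission where

-- Both statements reduce to one algebraic fact, the decrement identity: if
-- zᵢ yᵢ = 1 and kᵢ ≥ 1, then Σⱼ y^(k - eⱼ) = (z₁ + ⋯ + z_r) · y^k.
--  * Finite part. Applied termwise to ω_n with yᵢ = 1/mᵢ, zᵢ = mᵢ (where
--    m₁ + ⋯ + m_r = n) it gives Σⱼ ω_n(k - eⱼ) = n · ω_n(k) exactly.  For
--    n = p prime and r ≥ 2 every part mᵢ lies in (0, p), so ω_p(k) is
--    p-integral and p · ω_p(k) vanishes modulo p.
--  * Real part. In each Mordell–Tornheim term the variables are 1/m₁, …,
--    1/m_{r-1} and -1/(m₁ + ⋯ + m_{r-1}), whose reciprocals sum to 0; hence
--    the truncations of Σⱼ Ω(k - eⱼ) over every box [1, N]^{r-1} are 0.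
-- The file develops finite sums, the decrement identity, the arithmetic of
-- unit fractions, p-integrality, the two parts, and finally the corollary.
-- Both parts in fact only need kᵢ ≥ 1.

open import Defs
open import Data.Nat as ℕ using (ℕ; zero; suc; _^_; _∸_; _≤_; _<_; s≤s; z≤n)
import Data.Nat.Properties as ℕP
open import Data.Nat.ListAction renaming (sum to sumℕ)
import Data.Nat.Coprimality as C
open import Data.Nat.Primality using (Prime; euclidsLemma; prime⇒nonTrivial)
open import Data.Nat.Divisibility using (_∣_; divides; ∣-trans; ∣⇒≤; m∣m*n; ∣m⇒∣m*n)
open import Data.Integer as ℤ using (ℤ)
import Data.Integer.Properties as ℤP
open import Data.Rational as ℚ using (ℚ; 0ℚ; 1ℚ; _+_; _*_; -_; 1/_; ↧ₙ_; mkℚ)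
import Data.Rational.Properties as ℚP
open import Data.Rational.Unnormalised as U using (mkℚᵘ; *≡*)
import Data.Rational.Unnormalised.Properties as UP
open import Data.Rational.Solver using (module +-*-Solver)
open import Data.List using (List; []; _∷_; length; map; upTo)
import Data.List.Properties as LP
open import Data.List.Properties using (map-upTo)
open import Data.List.Relation.Unary.All as All using (All; []; _∷_)
import Data.List.Relation.Unary.All.Properties as AllP
open import Data.Product using (_×_; _,_; Σ; ∃)
open import Data.Sum using (inj₁; inj₂; [_,_]′)
open import Data.Empty using (⊥-elim)
open import Relation.Nullary using (¬_)
open import Relation.Binary.PropositionalEquality

open +-*-Solver

Σ-cong : ∀ {A : Set} {f g : A → ℚ} (xs : List A) → (∀ x → f x ≡ g x) →
  Σℚ (map f xs) ≡ Σℚ (map g xs)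
Σ-cong []       f≗g = refl
Σ-cong (x ∷ xs) f≗g = cong₂ _+_ (f≗g x) (Σ-cong xs f≗g)

Σ-cong-All : ∀ {A : Set} {f g : A → ℚ} {xs : List A} → All (λ x → f x ≡ g x) xs →
  Σℚ (map f xs) ≡ Σℚ (map g xs)
Σ-cong-All []           = refl
Σ-cong-All (fx≡gx ∷ eqs) = cong₂ _+_ fx≡gx (Σ-cong-All eqs)

Σ-zero : ∀ {A : Set} (xs : List A) → Σℚ (map (λ _ → 0ℚ) xs) ≡ 0ℚ
Σ-zero []       = refl
Σ-zero (x ∷ xs) = cong (0ℚ +_) (Σ-zero xs)

Σ-+ : ∀ {A : Set} (f g : A → ℚ) (xs : List A) →
  Σℚ (map (λ x → f x + g x) xs) ≡ Σℚ (map f xs) + Σℚ (map g xs)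
Σ-+ f g []       = refl
Σ-+ f g (x ∷ xs) = begin
    (f x + g x) + Σℚ (map (λ x → f x + g x) xs)
  ≡⟨ cong ((f x + g x) +_) (Σ-+ f g xs) ⟩
    (f x + g x) + (F + G)
  ≡⟨ solve 4 (λ a b c d → (a :+ b) :+ (c :+ d) := (a :+ c) :+ (b :+ d)) refl (f x) (g x) F G ⟩
    (f x + F) + (g x + G)
  ∎
  where
  open ≡-Reasoning
  F = Σℚ (map f xs)
  G = Σℚ (map g xs)

Σ-*ˡ : ∀ {A : Set} (c : ℚ) (f : A → ℚ) (xs : List A) →
  Σℚ (map (λ x → c * f x) xs) ≡ c * Σℚ (map f xs)
Σ-*ˡ c f []       = sym (ℚP.*-zeroʳ c)
Σ-*ˡ c f (x ∷ xs) =
  trans (cong (c * f x +_) (Σ-*ˡ c f xs)) (sym (ℚP.*-distribˡ-+ c (f x) (Σℚ (map f xs))))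

Σ-swap : ∀ {A B : Set} (f : A → B → ℚ) (xs : List A) (ys : List B) →
  Σℚ (map (λ x → Σℚ (map (f x) ys)) xs) ≡ Σℚ (map (λ y → Σℚ (map (λ x → f x y) xs)) ys)
Σ-swap f []       ys = sym (Σ-zero ys)
Σ-swap f (x ∷ xs) ys =
  trans (cong (Σℚ (map (f x) ys) +_) (Σ-swap f xs ys))
        (sym (Σ-+ (f x) (λ y → Σℚ (map (λ x → f x y) xs)) ys))

Σ-upTo-suc : ∀ (f : ℕ → ℚ) r →
  Σℚ (map f (upTo (suc r))) ≡ f 0 + Σℚ (map (λ j → f (suc j)) (upTo r))
Σ-upTo-suc f r =
  cong Σℚ (trans (map-upTo f (suc r)) (cong (f 0 ∷_) (sym (map-upTo (λ j → f (suc j)) r))))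

pw : ℚ → ℕ → ℚ
pw x zero    = 1ℚ
pw x (suc n) = x * pw x n

monomial : List ℚ → Index → ℚ
monomial (y ∷ ys) (k ∷ ks) = pw y k * monomial ys ks
monomial _        _        = 1ℚ

data Reciprocals : List ℚ → List ℚ → Index → Set where
  []   : Reciprocals [] [] []
  cons : ∀ {y z k ys zs ks} → z * y ≡ 1ℚ → 1 ≤ k → Reciprocals ys zs ks →
         Reciprocals (y ∷ ys) (z ∷ zs) (k ∷ ks)

-- The decrement identity, the heart of both parts of the theorem: lowering
-- one exponent kⱼ by one multiplies the monomial by zⱼ = yⱼ⁻¹, so
--   Σⱼ y^(k - eⱼ) = (z₁ + ⋯ + z_r) · y^k.
decrement-identity : ∀ {ys zs k} → Reciprocals ys zs k →
  sumDec (monomial ys) k ≡ Σℚ zs * monomial ys k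
decrement-identity [] = refl
decrement-identity {y ∷ ys} {z ∷ zs} {suc k ∷ ks} (cons zy≡1 _ rec) = begin
    sumDec (monomial (y ∷ ys)) (suc k ∷ ks)
  ≡⟨ Σ-upTo-suc (λ j → monomial (y ∷ ys) (decAt j (suc k ∷ ks))) (length ks) ⟩
    P * M + Σℚ (map (λ j → y * P * monomial ys (decAt j ks)) (upTo (length ks)))
  ≡⟨ cong (P * M +_) (Σ-*ˡ (y * P) (λ j → monomial ys (decAt j ks)) (upTo (length ks))) ⟩
    P * M + y * P * sumDec (monomial ys) ks
  ≡⟨ cong (λ t → P * M + y * P * t) (decrement-identity rec) ⟩
    P * M + y * P * (Σℚ zs * M)
  ≡⟨ cong (_+ y * P * (Σℚ zs * M)) (sym (ℚP.*-identityˡ (P * M))) ⟩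
    1ℚ * (P * M) + y * P * (Σℚ zs * M)
  ≡⟨ cong (λ t → t * (P * M) + y * P * (Σℚ zs * M)) (sym zy≡1) ⟩
    z * y * (P * M) + y * P * (Σℚ zs * M)
  ≡⟨ solve 5 (λ z y P S M → z :* y :* (P :* M) :+ y :* P :* (S :* M) := (z :+ S) :* (y :* P :* M))
           refl z y P (Σℚ zs) M ⟩
    (z + Σℚ zs) * (y * P * M)
  ∎
  where
  open ≡-Reasoning
  P = pw y k
  M = monomial ys ks

insertAt : ℕ → ℚ → List ℚ → List ℚ
insertAt zero    c ys       = c ∷ ys
insertAt (suc a) c []       = c ∷ []
insertAt (suc a) c (y ∷ ys) = y ∷ insertAt a c ys

Σ-insertAt : ∀ a c ys → Σℚ (insertAt a c ys) ≡ c + Σℚ ys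
Σ-insertAt zero    c ys       = refl
Σ-insertAt (suc a) c []       = refl
Σ-insertAt (suc a) c (y ∷ ys) =
  trans (cong (y +_) (Σ-insertAt a c ys))
        (solve 3 (λ y c S → y :+ (c :+ S) := c :+ (y :+ S)) refl y c (Σℚ ys))

monomial-insertAt : ∀ a c ys k → length ys ≡ length (removeAt a k) →
  monomial (insertAt a c ys) k ≡ pw c (lookupD k a) * monomial ys (removeAt a k)
monomial-insertAt zero    c []       []       _ = refl
monomial-insertAt zero    c ys       (k ∷ ks) _ = refl
monomial-insertAt (suc a) c []       []       _ = refl
monomial-insertAt (suc a) c (y ∷ ys) (k ∷ ks) len =
  trans (cong (pw y k *_) (monomial-insertAt a c ys ks (ℕP.suc-injective len)))
        (solve 3 (λ A B C → A :* (B :* C) := B :* (A :* C)) refl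
               (pw y k) (pw c (lookupD ks a)) (monomial ys (removeAt a ks)))

Reciprocals-insertAt : ∀ {a c d ys zs k} → Reciprocals ys zs (removeAt a k) →
  d * c ≡ 1ℚ → 1 ≤ lookupD k a → a < length k →
  Reciprocals (insertAt a c ys) (insertAt a d zs) k
Reciprocals-insertAt {zero}  {k = k ∷ ks} rec dc≡1 1≤kₐ _ = cons dc≡1 1≤kₐ rec
Reciprocals-insertAt {suc a} {k = k ∷ ks} (cons zy≡1 1≤k rec) dc≡1 1≤kₐ (s≤s a<r) =
  cons zy≡1 1≤k (Reciprocals-insertAt rec dc≡1 1≤kₐ a<r)

ι : ℕ → ℚ
ι m = mkℚ (ℤ.+ m) 0 (C.sym (C.1-coprimeTo m))

inv-suc : ∀ a → inv (suc a) ≡ 1/ ι (suc a)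
inv-suc a = ℚP.normalize-coprime (C.1-coprimeTo (suc a))

ι-inv : ∀ a → ι (suc a) * inv (suc a) ≡ 1ℚ
ι-inv a = trans (cong (ι (suc a) *_) (inv-suc a)) (ℚP.*-inverseʳ (ι (suc a)))

ι-+ : ∀ a b → ι (a ℕ.+ b) ≡ ι a + ι b
ι-+ a b = ℚP.toℚᵘ-injective (UP.≃-sym (UP.≃-trans (ℚP.toℚᵘ-homo-+ (ι a) (ι b)) (*≡* cross)))
  where
  cross : (ℤ.+ a ℤ.* ℤ.+ 1 ℤ.+ ℤ.+ b ℤ.* ℤ.+ 1) ℤ.* ℤ.+ 1 ≡ ℤ.+ (a ℕ.+ b) ℤ.* ℤ.+ 1
  cross = cong (ℤ._* ℤ.+ 1) (cong₂ ℤ._+_ (ℤP.*-identityʳ (ℤ.+ a)) (ℤP.*-identityʳ (ℤ.+ b)))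

-- 1/(mn) = (1/m)(1/n); this holds for all m, n because inv 0 = 0.
inv-* : ∀ m n → inv (m ℕ.* n) ≡ inv m * inv n
inv-* zero    n       = sym (ℚP.*-zeroˡ (inv n))
inv-* (suc a) zero    = trans (cong inv (ℕP.*-zeroʳ a)) (sym (ℚP.*-zeroʳ (inv (suc a))))
inv-* (suc a) (suc b) = begin
    inv (suc a ℕ.* suc b)
  ≡⟨ inv-suc (b ℕ.+ a ℕ.* suc b) ⟩
    1/ ι (suc a ℕ.* suc b)
  ≡⟨ ℚP.toℚᵘ-injective (UP.≃-sym (UP.≃-trans (ℚP.toℚᵘ-homo-* (1/ ι (suc a)) (1/ ι (suc b)))
                                              (*≡* refl))) ⟩
    1/ ι (suc a) * 1/ ι (suc b)
  ≡⟨ sym (cong₂ _*_ (inv-suc a) (inv-suc b)) ⟩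
    inv (suc a) * inv (suc b)
  ∎
  where open ≡-Reasoning

inv-^ : ∀ m k → inv (m ^ k) ≡ pw (inv m) k
inv-^ m zero    = refl
inv-^ m (suc k) = trans (inv-* m (m ^ k)) (cong (inv m *_) (inv-^ m k))

prodInv-monomial : ∀ (m : List ℕ) k → prodInv m k ≡ monomial (map inv m) k
prodInv-monomial []      []       = refl
prodInv-monomial []      (k ∷ ks) = refl
prodInv-monomial (x ∷ m) []       = refl
prodInv-monomial (x ∷ m) (k ∷ ks) = cong₂ _*_ (inv-^ x k) (prodInv-monomial m ks)

Σ-ι : ∀ (m : List ℕ) → Σℚ (map ι m) ≡ ι (sumℕ m)
Σ-ι []      = refl
Σ-ι (x ∷ m) = trans (cong (ι x +_) (Σ-ι m)) (sym (ι-+ x (sumℕ m)))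

Reciprocals-parts : ∀ (m : List ℕ) k → All (1 ≤_) m → All (1 ≤_) k → length m ≡ length k →
  Reciprocals (map inv m) (map ι m) k
Reciprocals-parts []          []       _          _            _   = []
Reciprocals-parts (suc a ∷ m) (k ∷ ks) (_ ∷ m≥1) (1≤k ∷ ks≥1) len =
  cons (ι-inv a) 1≤k (Reciprocals-parts m ks m≥1 ks≥1 (ℕP.suc-injective len))

sign-pw : ∀ x l → signℚ l * pw x l ≡ pw (- x) l
sign-pw x zero          = refl
sign-pw x (suc zero)    = solve 1 (λ x → (:- con 1ℚ) :* (x :* con 1ℚ) := (:- x) :* con 1ℚ) refl x
sign-pw x (suc (suc l)) = begin
    signℚ l * (x * (x * pw x l))
  ≡⟨ solve 3 (λ s x P → s :* (x :* (x :* P)) := (:- x) :* ((:- x) :* (s :* P))) refl (signℚ l) x (pw x l) ⟩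
    (- x) * ((- x) * (signℚ l * pw x l))
  ≡⟨ cong (λ t → (- x) * ((- x) * t)) (sign-pw x l) ⟩
    (- x) * ((- x) * pw (- x) l)
  ∎
  where open ≡-Reasoning

length-decAt : ∀ j k → length (decAt j k) ≡ length k
length-decAt _       []       = refl
length-decAt zero    (k ∷ ks) = refl
length-decAt (suc j) (k ∷ ks) = cong suc (length-decAt j ks)

length-removeAt : ∀ a k → a < length k → length (removeAt a k) ≡ length k ∸ 1
length-removeAt zero    (k ∷ ks)      _         = refl
length-removeAt (suc a) (k ∷ k′ ∷ ks) (s≤s a<r) = cong suc (length-removeAt a (k′ ∷ ks) a<r)

All-removeAt : ∀ {P : ℕ → Set} a k → All P k → All P (removeAt a k)
All-removeAt _       []       []         = []
All-removeAt zero    (k ∷ ks) (_ ∷ pks)  = pks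
All-removeAt (suc a) (k ∷ ks) (pk ∷ pks) = pk ∷ All-removeAt a ks pks

All-lookupD : ∀ {P : ℕ → Set} a k → All P k → a < length k → P (lookupD k a)
All-lookupD zero    (k ∷ ks) (pk ∷ _)   _         = pk
All-lookupD (suc a) (k ∷ ks) (_ ∷ pks) (s≤s a<r) = All-lookupD a ks pks a<r

upTo-< : ∀ r → All (_< r) (upTo r)
upTo-< r = AllP.applyUpTo⁺₁ (λ i → i) r (λ i<r → i<r)

oneTo-bounds : ∀ n → All (λ x → 1 ≤ x × x ≤ n) (oneTo n)
oneTo-bounds n = AllP.map⁺ (All.map (λ i<n → s≤s z≤n , i<n) (upTo-< n))

box-points : ∀ s N → All (λ m → length m ≡ s × All (1 ≤_) m) (box s N)
box-points zero    N = (refl , []) ∷ []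
box-points (suc s) N = AllP.concat⁺ (AllP.map⁺ (All.map
  (λ (1≤x , _) → AllP.map⁺ (All.map (λ (len , m≥1) → cong suc len , 1≤x ∷ m≥1) (box-points s N)))
  (oneTo-bounds N)))

composition-parts : ∀ r n →
  All (λ m → length m ≡ r × All (1 ≤_) m × sumℕ m ≡ n) (compositions r n)
composition-parts zero    zero    = (refl , [] , refl) ∷ []
composition-parts zero    (suc n) = []
composition-parts (suc r) n = AllP.concat⁺ (AllP.map⁺ (All.map
  (λ {x} (1≤x , x≤n∸r) → AllP.map⁺ (All.map
     (λ (len , m≥1 , sum≡) → cong suc len , 1≤x ∷ m≥1 ,
        trans (cong (x ℕ.+_) sum≡) (ℕP.m+[n∸m]≡n (ℕP.≤-trans x≤n∸r (ℕP.m∸n≤m n r))))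
     (composition-parts r (n ∸ x))))
  (oneTo-bounds (n ∸ r))))

sum-positive : ∀ (m : List ℕ) → All (1 ≤_) m → 1 ≤ length m → 1 ≤ sumℕ m
sum-positive (x ∷ m) (1≤x ∷ _) _ = ℕP.≤-trans 1≤x (ℕP.m≤m+n x (sumℕ m))

part≤sum : ∀ (m : List ℕ) → All (_≤ sumℕ m) m
part≤sum []      = []
part≤sum (x ∷ m) = ℕP.m≤m+n x (sumℕ m)
  ∷ All.map (λ y≤ → ℕP.≤-trans y≤ (ℕP.m≤n+m (sumℕ m) x)) (part≤sum m)

part<sum : ∀ (m : List ℕ) → All (1 ≤_) m → 2 ≤ length m → All (_< sumℕ m) m
part<sum (x ∷ m) (1≤x ∷ m≥1) (s≤s 1≤r) =
  ℕP.m<m+n x (sum-positive m m≥1 1≤r)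
  ∷ All.map (λ y≤ → ℕP.≤-<-trans y≤ (ℕP.m<n+m (sumℕ m) 1≤x)) (part≤sum m)

-- Part 1, over ℚ: Σⱼ ωₙ(k - eⱼ) = n · ωₙ(k) for every n, as soon as all kᵢ ≥ 1.
-- Termwise this is the decrement identity with yᵢ = 1/mᵢ, zᵢ = mᵢ, Σ zᵢ = n.
sumDec-ω : ∀ n k → All (1 ≤_) k → sumDec (ω n) k ≡ ι n * ω n k
sumDec-ω n k k≥1 = begin
    sumDec (ω n) k
  ≡⟨ Σ-cong (upTo r) (λ j → cong (λ l → Σℚ (map (λ m → prodInv m (decAt j k)) (compositions l n)))
                                 (length-decAt j k)) ⟩
    Σℚ (map (λ j → Σℚ (map (λ m → prodInv m (decAt j k)) Cs)) (upTo r))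
  ≡⟨ Σ-swap (λ j m → prodInv m (decAt j k)) (upTo r) Cs ⟩
    Σℚ (map (λ m → sumDec (λ k′ → prodInv m k′) k) Cs)
  ≡⟨ Σ-cong-All (All.map (λ {m} (len , m≥1 , sum≡n) → per-composition m len m≥1 sum≡n)
                         (composition-parts r n)) ⟩
    Σℚ (map (λ m → ι n * prodInv m k) Cs)
  ≡⟨ Σ-*ˡ (ι n) (λ m → prodInv m k) Cs ⟩
    ι n * ω n k
  ∎
  where
  open ≡-Reasoning
  r  = length k
  Cs = compositions r n
  per-composition : ∀ m → length m ≡ r → All (1 ≤_) m → sumℕ m ≡ n →
    sumDec (λ k′ → prodInv m k′) k ≡ ι n * prodInv m k
  per-composition m len m≥1 sum≡n = begin
      sumDec (λ k′ → prodInv m k′) k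
    ≡⟨ Σ-cong (upTo r) (λ j → prodInv-monomial m (decAt j k)) ⟩
      sumDec (monomial (map inv m)) k
    ≡⟨ decrement-identity (Reciprocals-parts m k m≥1 k≥1 len) ⟩
      Σℚ (map ι m) * monomial (map inv m) k
    ≡⟨ cong₂ _*_ (trans (Σ-ι m) (cong ι sum≡n)) (sym (prodInv-monomial m k)) ⟩
      ι n * prodInv m k
    ∎

-- p-integral rationals: those admitting a representative a/b with p ∤ b.
-- They form a subring of ℚ, and p · x reduces to 0 modulo p for p-integral x.
pIntegral : ℕ → ℚ → Set
pIntegral p x = Σ ℤ λ a → Σ ℕ λ b → (¬ p ∣ suc b) × (ℚ.toℚᵘ x U.≃ mkℚᵘ a b)

module _ {p : ℕ} (p-prime : Prime p) where

  private
    p>1 : 1 < p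
    p>1 = ℕ.nonTrivial⇒n>1 p {{prime⇒nonTrivial p-prime}}

    p∤1 : ¬ p ∣ 1
    p∤1 p∣1 = ℕP.<⇒≱ p>1 (∣⇒≤ p∣1)

    p∤* : ∀ {b d} → ¬ p ∣ b → ¬ p ∣ d → ¬ p ∣ b ℕ.* d
    p∤* {b} {d} p∤b p∤d p∣bd = [ p∤b , p∤d ]′ (euclidsLemma b d p-prime p∣bd)

  integral-1 : pIntegral p 1ℚ
  integral-1 = ℤ.+ 1 , 0 , p∤1 , UP.≃-refl

  integral-+ : ∀ {x y} → pIntegral p x → pIntegral p y → pIntegral p (x + y)
  integral-+ {x} {y} (_ , _ , p∤b , x≃) (_ , _ , p∤d , y≃) =
    _ , _ , p∤* p∤b p∤d , UP.≃-trans (ℚP.toℚᵘ-homo-+ x y) (UP.+-cong x≃ y≃)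

  integral-* : ∀ {x y} → pIntegral p x → pIntegral p y → pIntegral p (x * y)
  integral-* {x} {y} (_ , _ , p∤b , x≃) (_ , _ , p∤d , y≃) =
    _ , _ , p∤* p∤b p∤d , UP.≃-trans (ℚP.toℚᵘ-homo-* x y) (UP.*-cong x≃ y≃)

  integral-Σ : ∀ {xs} → All (pIntegral p) xs → pIntegral p (Σℚ xs)
  integral-Σ []         = ℤ.+ 0 , 0 , p∤1 , UP.≃-refl
  integral-Σ (ix ∷ ixs) = integral-+ ix (integral-Σ ixs)

  integral-pw : ∀ {x} → pIntegral p x → ∀ k → pIntegral p (pw x k)
  integral-pw ix zero    = integral-1
  integral-pw ix (suc k) = integral-* ix (integral-pw ix k)

  integral-inv : ∀ a → suc a < p → pIntegral p (inv (suc a))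
  integral-inv a a<p = ℤ.+ 1 , a , (λ p∣ → ℕP.<⇒≱ a<p (∣⇒≤ p∣)) ,
    UP.≃-reflexive (cong ℚ.toℚᵘ (inv-suc a))

  integral-prodInv : ∀ (m : List ℕ) k → All (λ x → 1 ≤ x × x < p) m → pIntegral p (prodInv m k)
  integral-prodInv []          []       _ = integral-1
  integral-prodInv []          (_ ∷ _)  _ = integral-1
  integral-prodInv (_ ∷ _)     []       _ = integral-1
  integral-prodInv (suc a ∷ m) (k ∷ ks) ((_ , a<p) ∷ m-bounds) =
    integral-* (subst (pIntegral p) (sym (inv-^ (suc a) k)) (integral-pw (integral-inv a a<p) k))
               (integral-prodInv m ks m-bounds)

  -- With r ≥ 2 parts, every part of a composition of p lies strictly between 0
  -- and p, so ω_p(k) is p-integral.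
  integral-ω : ∀ k → 2 ≤ length k → pIntegral p (ω p k)
  integral-ω k r≥2 = integral-Σ (AllP.map⁺ (All.map
    (λ {m} (len , m≥1 , sum≡p) → integral-prodInv m k
       (All.zip (m≥1 , subst (λ s → All (_< s) m) sum≡p (part<sum m m≥1 (subst (2 ≤_) (sym len) r≥2)))))
    (composition-parts (length k) p)))

  integral⇒p∤denominator : ∀ x → pIntegral p x → ¬ p ∣ ↧ₙ x
  integral⇒p∤denominator (mkℚ n d coprime) (a , b , p∤b , *≡* cross) p∣d = p∤b (∣-trans p∣d d∣b)
    where
    cross′ : ℤ.∣ n ∣ ℕ.* suc b ≡ ℤ.∣ a ∣ ℕ.* suc d
    cross′ = trans (sym (ℤP.abs-* n (ℤ.+ suc b))) (trans (cong ℤ.∣_∣ cross) (ℤP.abs-* a (ℤ.+ suc d)))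
    d∣b : suc d ∣ suc b
    d∣b = C.coprime-divisor (C.sym (C.recompute coprime)) (divides ℤ.∣ a ∣ cross′)

  p*-≡0mod : ∀ w → ¬ p ∣ ↧ₙ w → ≡0mod p (ι p * w)
  p*-≡0mod w@(mkℚ n d _) p∤d = reduce (ι p * w) (ℚP.toℚᵘ-homo-* (ι p) w)
    where
    reduce : ∀ v → ℚ.toℚᵘ v U.≃ ℚ.toℚᵘ (ι p) U.* ℚ.toℚᵘ w → ≡0mod p v
    reduce (mkℚ n′ d′ coprime′) (*≡* cross) = p∤d′ , p∣n′
      where
      cross′ : ℤ.∣ n′ ∣ ℕ.* suc (d ℕ.+ 0) ≡ p ℕ.* ℤ.∣ n ∣ ℕ.* suc d′
      cross′ = trans (sym (ℤP.abs-* n′ _)) (trans (cong ℤ.∣_∣ cross)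
                 (trans (ℤP.abs-* (ℤ.+ p ℤ.* n) _) (cong (ℕ._* suc d′) (ℤP.abs-* (ℤ.+ p) n))))
      p∣n′ : p ∣ ℤ.∣ n′ ∣
      p∣n′ with euclidsLemma ℤ.∣ n′ ∣ (suc (d ℕ.+ 0)) p-prime
                 (subst (p ∣_) (sym cross′) (∣m⇒∣m*n (suc d′) (m∣m*n ℤ.∣ n ∣)))
      ... | inj₁ p∣n′   = p∣n′
      ... | inj₂ p∣d+0 = ⊥-elim (p∤d (subst (λ t → p ∣ suc t) (ℕP.+-identityʳ d) p∣d+0))
      p∤d′ : ¬ p ∣ suc d′
      p∤d′ p∣d′ = ℕP.<⇒≢ p>1 (sym (C.recompute coprime′ (p∣n′ , p∣d′)))

-- Part 2. Expanding Ω-partial n (k - eⱼ) as a sum over removed positions a and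
-- box points m, the terms with fixed (a, m) sum to zero over j: they are the
-- monomials of the decrement identity in the variables 1/m₁, …, 1/m_{r-1} with
-- -1/(m₁ + ⋯ + m_{r-1}) inserted at position a, whose reciprocals sum to 0.

mtTerm : Index → ℕ → List ℕ → ℚ
mtTerm k′ a m = signℚ (lookupD k′ a) * (prodInv m (removeAt a k′) * inv (sumℕ m ^ lookupD k′ a))

length-removeAt-decAt : ∀ a j k → a < length k → length (removeAt a (decAt j k)) ≡ length k ∸ 1
length-removeAt-decAt a j k a<r =
  trans (length-removeAt a (decAt j k) (subst (a <_) (sym (length-decAt j k)) a<r))
        (cong (_∸ 1) (length-decAt j k))

Ω-partial-decAt : ∀ n k j → Ω-partial n (decAt j k) ≡
  Σℚ (map (λ a → Σℚ (map (mtTerm (decAt j k) a) (box (length k ∸ 1) n))) (upTo (length k)))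
Ω-partial-decAt n k j =
  trans (cong (λ l → Σℚ (map summand (upTo l))) (length-decAt j k))
        (Σ-cong-All (All.map (λ {a} a<r → expand a a<r) (upTo-< (length k))))
  where
  k′ = decAt j k
  summand : ℕ → ℚ
  summand a = signℚ (lookupD k′ a) * ζMT-partial n (removeAt a k′) (lookupD k′ a)
  expand : ∀ a → a < length k → summand a ≡ Σℚ (map (mtTerm k′ a) (box (length k ∸ 1) n))
  expand a a<r =
    trans (sym (Σ-*ˡ (signℚ (lookupD k′ a))
                     (λ m → prodInv m (removeAt a k′) * inv (sumℕ m ^ lookupD k′ a))
                     (box (length (removeAt a k′)) n)))
          (cong (λ l → Σℚ (map (mtTerm k′ a) (box l n))) (length-removeAt-decAt a j k a<r))

mtTerm-monomial : ∀ k′ a m s → sumℕ m ≡ suc s → length m ≡ length (removeAt a k′) →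
  mtTerm k′ a m ≡ monomial (insertAt a (- inv (suc s)) (map inv m)) k′
mtTerm-monomial k′ a m s sum≡ len = begin
    signℚ l * (prodInv m R * inv (sumℕ m ^ l))
  ≡⟨ cong₂ (λ u v → signℚ l * (u * v)) (prodInv-monomial m R)
           (trans (cong (λ t → inv (t ^ l)) sum≡) (inv-^ (suc s) l)) ⟩
    signℚ l * (monomial (map inv m) R * pw (inv (suc s)) l)
  ≡⟨ solve 3 (λ A B C → A :* (B :* C) := (A :* C) :* B) refl
           (signℚ l) (monomial (map inv m) R) (pw (inv (suc s)) l) ⟩
    (signℚ l * pw (inv (suc s)) l) * monomial (map inv m) R
  ≡⟨ cong (_* monomial (map inv m) R) (sign-pw (inv (suc s)) l) ⟩
    pw (- inv (suc s)) l * monomial (map inv m) R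
  ≡⟨ sym (monomial-insertAt a (- inv (suc s)) (map inv m) k′ (trans (LP.length-map inv m) len)) ⟩
    monomial (insertAt a (- inv (suc s)) (map inv m)) k′
  ∎
  where
  open ≡-Reasoning
  l = lookupD k′ a
  R = removeAt a k′

column-vanishes : ∀ k a m s → All (1 ≤_) k → a < length k →
  length m ≡ length k ∸ 1 → All (1 ≤_) m → sumℕ m ≡ suc s →
  sumDec (λ k′ → mtTerm k′ a m) k ≡ 0ℚ
column-vanishes k a m s k≥1 a<r len m≥1 sum≡ = begin
    sumDec (λ k′ → mtTerm k′ a m) k
  ≡⟨ Σ-cong (upTo (length k)) (λ j → mtTerm-monomial (decAt j k) a m s sum≡
                                        (trans len (sym (length-removeAt-decAt a j k a<r)))) ⟩
    sumDec (monomial ys) k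
  ≡⟨ decrement-identity reciprocals ⟩
    Σℚ zs * monomial ys k
  ≡⟨ cong (_* monomial ys k) Σzs≡0 ⟩
    0ℚ * monomial ys k
  ≡⟨ ℚP.*-zeroˡ (monomial ys k) ⟩
    0ℚ
  ∎
  where
  open ≡-Reasoning
  S  = ι (suc s)
  ys = insertAt a (- inv (suc s)) (map inv m)
  zs = insertAt a (- S) (map ι m)
  reciprocals : Reciprocals ys zs k
  reciprocals = Reciprocals-insertAt
    (Reciprocals-parts m (removeAt a k) m≥1 (All-removeAt a k k≥1) (trans len (sym (length-removeAt a k a<r))))
    (trans (solve 2 (λ x y → (:- x) :* (:- y) := x :* y) refl S (inv (suc s))) (ι-inv s))
    (All-lookupD a k k≥1 a<r) a<r
  Σzs≡0 : Σℚ zs ≡ 0ℚ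
  Σzs≡0 = trans (Σ-insertAt a (- S) (map ι m))
                (trans (cong (- S +_) (trans (Σ-ι m) (cong ι sum≡))) (ℚP.+-inverseˡ S))

sumDec-Ω-partial : ∀ n k → 2 ≤ length k → All (1 ≤_) k → sumDec (Ω-partial n) k ≡ 0ℚ
sumDec-Ω-partial n k r≥2 k≥1 = begin
    sumDec (Ω-partial n) k
  ≡⟨ Σ-cong (upTo r) (Ω-partial-decAt n k) ⟩
    Σℚ (map (λ j → Σℚ (map (λ a → Σℚ (map (mtTerm (decAt j k) a) B)) (upTo r))) (upTo r))
  ≡⟨ Σ-swap (λ j a → Σℚ (map (mtTerm (decAt j k) a) B)) (upTo r) (upTo r) ⟩
    Σℚ (map (λ a → Σℚ (map (λ j → Σℚ (map (mtTerm (decAt j k) a) B)) (upTo r))) (upTo r))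
  ≡⟨ Σ-cong (upTo r) (λ a → Σ-swap (λ j → mtTerm (decAt j k) a) (upTo r) B) ⟩
    Σℚ (map (λ a → Σℚ (map (λ m → sumDec (λ k′ → mtTerm k′ a m) k) B)) (upTo r))
  ≡⟨ Σ-cong-All (All.map (λ {a} a<r → trans (Σ-cong-All (All.map (column a a<r) (box-points (r ∸ 1) n)))
                                             (Σ-zero B))
                         (upTo-< r)) ⟩
    Σℚ (map (λ _ → 0ℚ) (upTo r))
  ≡⟨ Σ-zero (upTo r) ⟩
    0ℚ
  ∎
  where
  open ≡-Reasoning
  r = length k
  B = box (r ∸ 1) n
  column : ∀ a → a < r → ∀ {m} → length m ≡ r ∸ 1 × All (1 ≤_) m →
    sumDec (λ k′ → mtTerm k′ a m) k ≡ 0ℚ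
  column a a<r {m} (len , m≥1) = column-vanishes k a m (sumℕ m ∸ 1) k≥1 a<r len m≥1
    (sym (ℕP.m+[n∸m]≡n (sum-positive m m≥1 (subst (1 ≤_) (sym len) (ℕP.∸-monoˡ-≤ 1 r≥2)))))

corollary5p2 : (k : Index) → 2 ≤ length k → All (2 ≤_) k →
    (∃ λ N → (p : ℕ) → Prime p → N < p → ≡0mod p (sumDec (ω p) k))
    × ((ε : ℚ) → 0ℚ ℚ.< ε → ∃ λ N → (n : ℕ) → N ≤ n →
    ℚ.∣ sumDec (Ω-partial n) k ∣ ℚ.< ε)
corollary5p2 k r≥2 k≥2 = finite-part , real-part
  where
  k≥1 : All (1 ≤_) k
  k≥1 = All.map (ℕP.≤-trans (s≤s z≤n)) k≥2
  finite-part : ∃ λ N → (p : ℕ) → Prime p → N < p → ≡0mod p (sumDec (ω p) k)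
  finite-part = 0 , λ p p-prime _ →
    subst (≡0mod p) (sym (sumDec-ω p k k≥1))
      (p*-≡0mod p-prime (ω p k) (integral⇒p∤denominator p-prime (ω p k) (integral-ω p-prime k r≥2)))
  real-part : (ε : ℚ) → 0ℚ ℚ.< ε → ∃ λ N → (n : ℕ) → N ≤ n →
    ℚ.∣ sumDec (Ω-partial n) k ∣ ℚ.< ε
  real-part ε ε>0 = 0 , λ n _ →
    subst (λ x → ℚ.∣ x ∣ ℚ.< ε) (sym (sumDec-Ω-partial n k r≥2 k≥1)) ε>0
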